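{- Let $k,\ell,n$ be positive integers with $k\ge 5$, and set $s = \nu_2(k!) + \ell - b_k - 3$. Define $$f_k(n) = \sum_{i=1}^{\lceil k/2\rceil} \binom{k}{t_i} t_i^{\,n}\left(t_i^{2^{s+1}} - 1\right), \qquad t_i = 2i-1.$$ Let $m$ be an integer with $m \ge s+1$ and $2^m - m \ge s+3$. If $n \ge 2^m$, then $$S(n+2^m,k) \equiv S(n,k) \pmod{2^{m-b_k+\ell}}$$ if and only if $f_k(n) \equiv 0 \pmod{2^{2s+4}}$.
   Context: $S(n,k)$ denotes the Stirling number of the second kind. $\nu_2(z)$ is the exponent of the largest power of $2$ dividing the positive integer $z$. $b_k = \lceil \log_2 k\rceil - 2$. -}

module Defs where

open import Data.Nat
open import Data.Nat.Logarithm using (⌈log₂_⌉)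
open import Data.Nat.Combinatorics using (_C_)
open import Data.Nat.Properties using (m^n≢0)
open import Relation.Binary.PropositionalEquality using (_≡_)

S : ℕ → ℕ → ℕ
S zero    zero    = 1
S zero    (suc k) = 0
S (suc n) zero    = 0
S (suc n) (suc k) = suc k * S n (suc k) + S n k

-- 2-adic valuation with fuel (fuel ≥ z suffices); ν₂ 0 = 0 (only used for z > 0)
ν₂-fuel : ℕ → ℕ → ℕ
ν₂-fuel zero    z = 0
ν₂-fuel (suc f) zero = 0
ν₂-fuel (suc f) (suc z) with (suc z) % 2
... | zero  = suc (ν₂-fuel f ((suc z) / 2))
... | suc _ = 0

ν₂ : ℕ → ℕ
ν₂ z = ν₂-fuel z z

-- b_k = ⌈log₂ k⌉ - 2  (≥ 1 for k ≥ 5, so truncated subtraction is exact)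
b : ℕ → ℕ
b k = ⌈log₂ k ⌉ ∸ 2

-- s = ν₂(k!) + ℓ - b_k - 3  (nonnegative for k ≥ 5, ℓ ≥ 1)
sₖ : ℕ → ℕ → ℕ
sₖ k ℓ = ν₂ (k !) + ℓ ∸ b k ∸ 3

Σ₁ : ℕ → (ℕ → ℕ) → ℕ
Σ₁ zero    g = 0
Σ₁ (suc N) g = Σ₁ N g + g (suc N)

f : ℕ → ℕ → ℕ → ℕ
f k ℓ n = Σ₁ ⌈ k /2⌉ λ i → let t = 2 * i ∸ 1 in
  (k C t) * t ^ n * (t ^ (2 ^ (sₖ k ℓ + 1)) ∸ 1)

_≡_[mod2^_] : ℕ → ℕ → ℕ → Set
a ≡ c [mod2^ e ] = (a % 2 ^ e) {{m^n≢0 2 e}} ≡ (c % 2 ^ e) {{m^n≢0 2 e}}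

{-# OPTIONS --safe #-}

-- Put D = (−1)^k k! (S(n + 2^m, k) − S(n, k)). The explicit formula
-- (−1)^k k! S(n, k) = Σ_j (−1)^j C(k, j) j^n gives D = Σ_j (−1)^j C(k, j) j^n (j^(2^m) − 1).
-- Let r = m − s − 1 and T = 2s + 4. The terms with j even are divisible by 2^n, hence by 2^(r+T).
-- For odd t, y = t^(2^(s+1)) − 1 is divisible by 2^(s+3), and each further squaring maps y to
-- y(y + 2) = 2y + y², so t^(2^m) − 1 ≡ 2^r y (mod 2^(r+T)): the terms with j odd add up to
-- −2^r f_k(n) modulo 2^(r+T). Finally k! = 2^ν₂(k!) · odd and ν₂(k!) + (m − b_k + ℓ) = r + T,
-- so 2^(m−b_k+ℓ) divides the difference of Stirling numbers iff 2^(r+T) ∣ D iff 2^T ∣ f_k(n).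

module Submission where

module FiniteSum where

  open import Data.Nat as ℕ using (ℕ; zero; suc)
  import Data.Nat.Properties as ℕ
  open import Data.Integer using (ℤ; +_; 0ℤ; _+_; _*_; -_; _-_)
  open import Data.Integer.Properties using (+-identityˡ; +-identityʳ; +-assoc; *-zeroʳ; neg-distrib-+; pos-+)
  open import Data.Integer.Divisibility.Signed using (_∣_; divides; ∣m∣n⇒∣m+n)
  open import Data.Sum using (inj₁; inj₂)
  open import Data.Integer.Tactic.RingSolver using (solve-∀)
  open import Relation.Binary.PropositionalEquality
  open import Defs using (Σ₁)

  ∑ : ℕ → (ℕ → ℤ) → ℤ
  ∑ zero    g = 0ℤ
  ∑ (suc N) g = ∑ N g + g N

  syntax ∑ N (λ j → e) = ∑[ j < N ] e

  ∑-cong : ∀ N {f g : ℕ → ℤ} → (∀ j → f j ≡ g j) → ∑ N f ≡ ∑ N g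
  ∑-cong zero    f≗g = refl
  ∑-cong (suc N) f≗g = cong₂ _+_ (∑-cong N f≗g) (f≗g N)

  ∑-distrib-+ : ∀ N (f g : ℕ → ℤ) → ∑[ j < N ] (f j + g j) ≡ ∑ N f + ∑ N g
  ∑-distrib-+ zero    f g = refl
  ∑-distrib-+ (suc N) f g = begin
    ∑[ j < N ] (f j + g j) + (f N + g N) ≡⟨ cong (_+ (f N + g N)) (∑-distrib-+ N f g) ⟩
    ∑ N f + ∑ N g + (f N + g N)          ≡⟨ +-interchange (∑ N f) (∑ N g) (f N) (g N) ⟩
    ∑ N f + f N + (∑ N g + g N)          ∎
    where
    open ≡-Reasoning
    +-interchange : ∀ a b c d → a + b + (c + d) ≡ a + c + (b + d)
    +-interchange = solve-∀

  ∑-distrib-neg : ∀ N (f : ℕ → ℤ) → ∑[ j < N ] (- f j) ≡ - ∑ N f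
  ∑-distrib-neg zero    f = refl
  ∑-distrib-neg (suc N) f = trans (cong (_+ - f N) (∑-distrib-neg N f)) (sym (neg-distrib-+ (∑ N f) (f N)))

  ∑-distrib-- : ∀ N (f g : ℕ → ℤ) → ∑[ j < N ] (f j - g j) ≡ ∑ N f - ∑ N g
  ∑-distrib-- N f g = trans (∑-distrib-+ N f (λ j → - g j)) (cong (_+_ (∑ N f)) (∑-distrib-neg N g))

  ∑-distribˡ-* : ∀ N c (f : ℕ → ℤ) → ∑[ j < N ] (c * f j) ≡ c * ∑ N f
  ∑-distribˡ-* zero    c f = sym (*-zeroʳ c)
  ∑-distribˡ-* (suc N) c f = trans (cong (_+ c * f N) (∑-distribˡ-* N c f)) (distribˡ c (∑ N f) (f N))
    where
    distribˡ : ∀ c a b → c * a + c * b ≡ c * (a + b)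
    distribˡ = solve-∀

  ∑-suc : ∀ N (g : ℕ → ℤ) → ∑ (suc N) g ≡ g 0 + ∑[ j < N ] g (suc j)
  ∑-suc zero    g = trans (+-identityˡ (g 0)) (sym (+-identityʳ (g 0)))
  ∑-suc (suc N) g = trans (cong (_+ g (suc N)) (∑-suc N g)) (+-assoc (g 0) _ _)

  ∑-pad : ∀ {N M} (g : ℕ → ℤ) → N ℕ.≤ M → (∀ j → N ℕ.≤ j → g j ≡ 0ℤ) → ∑ M g ≡ ∑ N g
  ∑-pad {M = zero}  g ℕ.z≤n vanish = refl
  ∑-pad {N} {suc M} g N≤1+M vanish with ℕ.m≤n⇒m<n∨m≡n N≤1+M
  ... | inj₁ (ℕ.s≤s N≤M) = trans (cong₂ _+_ (∑-pad g N≤M vanish) (vanish M N≤M)) (+-identityʳ (∑ N g))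
  ... | inj₂ refl        = refl

  ∑-even-odd : ∀ M (g : ℕ → ℤ) → ∑ (M ℕ.+ M) g ≡ ∑[ i < M ] g (2 ℕ.* i) + ∑[ i < M ] g (suc (2 ℕ.* i))
  ∑-even-odd zero    g = refl
  ∑-even-odd (suc M) g rewrite ℕ.+-suc M M | ℕ.+-identityʳ M =
    trans (cong (λ x → x + g (M ℕ.+ M) + g (suc (M ℕ.+ M))) (∑-even-odd M g))
      (regroup (∑[ i < M ] g (2 ℕ.* i)) (∑[ i < M ] g (suc (2 ℕ.* i))) (g (M ℕ.+ M)) (g (suc (M ℕ.+ M))))
    where
    regroup : ∀ a b c d → a + b + c + d ≡ a + c + (b + d)
    regroup = solve-∀

  +-Σ₁ : ∀ N g → + Σ₁ N g ≡ ∑[ i < N ] (+ g (suc i))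
  +-Σ₁ zero    g = refl
  +-Σ₁ (suc N) g = trans (pos-+ (Σ₁ N g) (g (suc N))) (cong (_+ + g (suc N)) (+-Σ₁ N g))

  ∑-∣ : ∀ {d} N (g : ℕ → ℤ) → (∀ j → d ∣ g j) → d ∣ ∑ N g
  ∑-∣ zero    g d∣g = divides 0ℤ refl
  ∑-∣ (suc N) g d∣g = ∣m∣n⇒∣m+n (∑-∣ N g d∣g) (d∣g N)

module IntegerDivisibility where

  open import Data.Nat as ℕ using (ℕ; zero; suc)
  import Data.Nat.Properties as ℕ
  import Data.Nat.Divisibility as ℕ
  open import Data.Nat.DivMod using (_%_; _/_; m≡m%n+[m/n]*n; [m+kn]%n≡m%n)
  open import Data.Integer as ℤ using (ℤ; +_; 1ℤ; -1ℤ; _+_; _*_; -_; _-_; _^_)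
  open import Data.Integer.Properties
    using (pos-+; pos-*; *-comm; *-identityˡ; *-identityʳ; m-n≡m⊖n; ∣m⊖n∣≡∣n⊖m∣; ∣⊖∣-≤)
  open import Data.Integer.Divisibility.Signed
  open import Data.Integer.Tactic.RingSolver using (solve-∀)
  open import Data.Sum using (inj₁; inj₂)
  open import Function.Bundles using (_⇔_; mk⇔)
  open import Relation.Binary.PropositionalEquality

  2^_ : ℕ → ℤ
  2^ e = + (2 ℕ.^ e)

  2^-+ : ∀ a b → 2^ (a ℕ.+ b) ≡ 2^ a * 2^ b
  2^-+ a b = trans (cong +_ (ℕ.^-distribˡ-+-* 2 a b)) (pos-* (2 ℕ.^ a) (2 ℕ.^ b))

  2^-suc : ∀ e → 2^ suc e ≡ + 2 * 2^ e
  2^-suc e = pos-* 2 (2 ℕ.^ e)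

  ^-monoʳ-∣ : ∀ m {a b} → a ℕ.≤ b → m ℕ.^ a ℕ.∣ m ℕ.^ b
  ^-monoʳ-∣ m {a} {b} a≤b = subst (m ℕ.^ a ℕ.∣_) m^a*m^[b-a]≡m^b (ℕ.m∣m*n (m ℕ.^ (b ℕ.∸ a)))
    where
    m^a*m^[b-a]≡m^b : m ℕ.^ a ℕ.* m ℕ.^ (b ℕ.∸ a) ≡ m ℕ.^ b
    m^a*m^[b-a]≡m^b = trans (sym (ℕ.^-distribˡ-+-* m a (b ℕ.∸ a))) (cong (m ℕ.^_) (ℕ.m+[n∸m]≡n a≤b))

  2^-mono-∣ : ∀ {a b} → a ℕ.≤ b → 2^ a ∣ 2^ b
  2^-mono-∣ a≤b = ∣ᵤ⇒∣ (^-monoʳ-∣ 2 a≤b)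

  2^-∣-weaken : ∀ {a b x} → a ℕ.≤ b → 2^ b ∣ x → 2^ a ∣ x
  2^-∣-weaken a≤b = ∣-trans (2^-mono-∣ a≤b)

  2^-∣-* : ∀ {a b x y} → 2^ a ∣ x → 2^ b ∣ y → 2^ (a ℕ.+ b) ∣ x * y
  2^-∣-* {a} {b} (divides p refl) (divides q refl) = divides (p * q) (begin
    p * 2^ a * (q * 2^ b)  ≡⟨ interchange p (2^ a) q (2^ b) ⟩
    p * q * (2^ a * 2^ b)  ≡⟨ cong (p * q *_) (2^-+ a b) ⟨
    p * q * 2^ (a ℕ.+ b)   ∎)
    where
    open ≡-Reasoning
    interchange : ∀ x y z w → x * y * (z * w) ≡ x * z * (y * w)
    interchange = solve-∀

  2^-*-∣⇔ : ∀ a {e x} → 2^ e ∣ x ⇔ 2^ (a ℕ.+ e) ∣ 2^ a * x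
  2^-*-∣⇔ a {e} {x} = mk⇔
    (λ 2^e∣x → subst (_∣ 2^ a * x) (sym (2^-+ a e)) (*-monoʳ-∣ (2^ a) 2^e∣x))
    (λ 2^a+e∣2^ax → *-cancelˡ-∣ (2^ a) {{ℕ.m^n≢0 2 a}} (subst (_∣ 2^ a * x) (2^-+ a e) 2^a+e∣2^ax))

  odd-*-∣ : ∀ e c {x} → 2^ e ∣ + suc (2 ℕ.* c) * x → 2^ e ∣ x
  odd-*-∣ zero    c {x} _      = divides x (sym (*-identityʳ x))
  odd-*-∣ (suc e) c {x} 2^e+1∣ux with 2∣x
    where
    odd-* : + suc (2 ℕ.* c) * x ≡ x + + 2 * (+ c * x)
    odd-* = trans (cong (_* x) (trans (pos-+ 1 (2 ℕ.* c)) (cong (_+_ 1ℤ) (pos-* 2 c)))) (expand x (+ c))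
      where
      expand : ∀ x c → (1ℤ + + 2 * c) * x ≡ x + + 2 * (c * x)
      expand = solve-∀
    2∣x : + 2 ∣ x
    2∣x = ∣m+n∣n⇒∣m (subst (+ 2 ∣_) odd-* (2^-∣-weaken {1} {suc e} (ℕ.s≤s ℕ.z≤n) 2^e+1∣ux))
                    (∣m⇒∣m*n (+ c * x) ∣-refl)
  ... | divides y refl =
    subst₂ _∣_ (sym (2^-suc e)) (*-comm (+ 2) y) (*-monoʳ-∣ (+ 2) (odd-*-∣ e c 2^e∣uy))
    where
    2^e∣uy : 2^ e ∣ + suc (2 ℕ.* c) * y
    2^e∣uy = *-cancelˡ-∣ (+ 2) (subst₂ _∣_ (2^-suc e) (shuffle (+ suc (2 ℕ.* c)) y) 2^e+1∣ux)
      where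
      shuffle : ∀ u y → u * (y * + 2) ≡ + 2 * (u * y)
      shuffle = solve-∀

  odd-*-∣⇔ : ∀ {e} c {x} → 2^ e ∣ x ⇔ 2^ e ∣ + suc (2 ℕ.* c) * x
  odd-*-∣⇔ {e} c = mk⇔ (∣n⇒∣m*n (+ suc (2 ℕ.* c))) (odd-*-∣ e c)

  ∣-sign⇔ : ∀ {d x} j → d ∣ x ⇔ d ∣ -1ℤ ^ j * x
  ∣-sign⇔ {d} {x} j =
    mk⇔ (∣n⇒∣m*n (-1ℤ ^ j)) (λ d∣±x → subst (d ∣_) (sign-involutive j) (∣n⇒∣m*n (-1ℤ ^ j) d∣±x))
    where
    sign-involutive : ∀ j → -1ℤ ^ j * (-1ℤ ^ j * x) ≡ x
    sign-involutive zero    = trans (*-identityˡ (1ℤ * x)) (*-identityˡ x)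
    sign-involutive (suc j) = trans (squares (-1ℤ ^ j) x) (sign-involutive j)
      where
      squares : ∀ s x → -1ℤ * s * (-1ℤ * s * x) ≡ s * (s * x)
      squares = solve-∀

  x-[x-y]≡y : ∀ x y → x - (x - y) ≡ y
  x-[x-y]≡y = solve-∀

  ∣m-n⇒∣m⇔∣n : ∀ {d x y} → d ∣ x - y → d ∣ x ⇔ d ∣ y
  ∣m-n⇒∣m⇔∣n {d} {x} {y} d∣x-y = mk⇔
    (λ d∣x → subst (d ∣_) (x-[x-y]≡y x y) (∣m∣n⇒∣m-n d∣x d∣x-y))
    (λ d∣y → subst (d ∣_) ([x-y]+y≡x x y) (∣m∣n⇒∣m+n d∣x-y d∣y))
    where
    [x-y]+y≡x : ∀ x y → x - y + y ≡ x
    [x-y]+y≡x = solve-∀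

  ∣m⇒∣m-n⇔∣n : ∀ {d x y} → d ∣ x → d ∣ x - y ⇔ d ∣ y
  ∣m⇒∣m-n⇔∣n {d} {x} {y} d∣x = mk⇔
    (λ d∣x-y → subst (d ∣_) (x-[x-y]≡y x y) (∣m∣n⇒∣m-n d∣x d∣x-y))
    (∣m∣n⇒∣m-n d∣x)

  %≡%⇒∣- : ∀ a c M .{{_ : ℕ.NonZero M}} → a % M ≡ c % M → + M ∣ + a - + c
  %≡%⇒∣- a c M a%M≡c%M = divides (+ (a / M) - + (c / M)) (begin
    + a - + c
      ≡⟨ cong₂ (λ x y → + x - + y) (m≡m%n+[m/n]*n a M) (m≡m%n+[m/n]*n c M) ⟩
    + (a % M ℕ.+ a / M ℕ.* M) - + (c % M ℕ.+ c / M ℕ.* M)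
      ≡⟨ cong₂ _-_ (+[r+q*M] (a % M) (a / M)) (+[r+q*M] (c % M) (c / M)) ⟩
    + (a % M) + + (a / M) * + M - (+ (c % M) + + (c / M) * + M)
      ≡⟨ cong (λ r → + r + + (a / M) * + M - (+ (c % M) + + (c / M) * + M)) a%M≡c%M ⟩
    + (c % M) + + (a / M) * + M - (+ (c % M) + + (c / M) * + M)
      ≡⟨ cancel (+ (c % M)) (+ (a / M)) (+ (c / M)) (+ M) ⟩
    (+ (a / M) - + (c / M)) * + M ∎)
    where
    open ≡-Reasoning
    +[r+q*M] : ∀ r q → + (r ℕ.+ q ℕ.* M) ≡ + r + + q * + M
    +[r+q*M] r q = trans (pos-+ r (q ℕ.* M)) (cong (_+_ (+ r)) (pos-* q M))
    cancel : ∀ r x y m → r + x * m - (r + y * m) ≡ (x - y) * m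
    cancel = solve-∀

  ∣∸⇒%≡% : ∀ {a c M} .{{_ : ℕ.NonZero M}} → c ℕ.≤ a → M ℕ.∣ a ℕ.∸ c → a % M ≡ c % M
  ∣∸⇒%≡% {a} {c} {M} c≤a (ℕ.divides q a∸c≡q*M) = begin
    a % M                 ≡⟨ cong (_% M) (ℕ.m+[n∸m]≡n c≤a) ⟨
    (c ℕ.+ (a ℕ.∸ c)) % M ≡⟨ cong (λ d → (c ℕ.+ d) % M) a∸c≡q*M ⟩
    (c ℕ.+ q ℕ.* M) % M   ≡⟨ [m+kn]%n≡m%n c q M ⟩
    c % M                 ∎
    where open ≡-Reasoning

  ∣-⇒%≡% : ∀ a c M .{{_ : ℕ.NonZero M}} → + M ∣ + a - + c → a % M ≡ c % M
  ∣-⇒%≡% a c M M∣a-c with ℕ.≤-total c a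
  ... | inj₁ c≤a = ∣∸⇒%≡% c≤a (subst (M ℕ.∣_) ∣a-c∣≡a∸c (∣⇒∣ᵤ M∣a-c))
    where
    ∣a-c∣≡a∸c : ℤ.∣ + a - + c ∣ ≡ a ℕ.∸ c
    ∣a-c∣≡a∸c = trans (cong ℤ.∣_∣ (m-n≡m⊖n a c)) (trans (∣m⊖n∣≡∣n⊖m∣ a c) (∣⊖∣-≤ c≤a))
  ... | inj₂ a≤c = sym (∣∸⇒%≡% a≤c (subst (M ℕ.∣_) ∣a-c∣≡c∸a (∣⇒∣ᵤ M∣a-c)))
    where
    ∣a-c∣≡c∸a : ℤ.∣ + a - + c ∣ ≡ c ℕ.∸ a
    ∣a-c∣≡c∸a = trans (cong ℤ.∣_∣ (m-n≡m⊖n a c)) (∣⊖∣-≤ a≤c)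

  %≡%⇔∣- : ∀ a c M .{{_ : ℕ.NonZero M}} → a % M ≡ c % M ⇔ + M ∣ + a - + c
  %≡%⇔∣- a c M = mk⇔ (%≡%⇒∣- a c M) (∣-⇒%≡% a c M)

module ExplicitStirling where

  open import Data.Nat as ℕ using (ℕ; zero; suc; _!)
  import Data.Nat.Properties as ℕ
  open import Data.Nat.Combinatorics using (_C_; nC1≡n; k>n⇒nCk≡0; nCk+nC[k+1]≡[n+1]C[k+1])
  import Data.Nat.Tactic.RingSolver as ℕ-Solver
  open import Data.Integer using (ℤ; +_; 0ℤ; 1ℤ; -1ℤ; _+_; _*_; -_; _-_; _^_)
  open import Data.Integer.Properties using (+-identityˡ; pos-+; pos-*)
  open import Data.Integer.Tactic.RingSolver using (solve-∀)
  open import Function.Base using (_∘_)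
  open import Relation.Binary.PropositionalEquality
  open import Defs using (S)
  open FiniteSum

  [k+1]*[n+1]C[k+1]≡[n+1]*nCk : ∀ n k → suc k ℕ.* (suc n C suc k) ≡ suc n ℕ.* (n C k)
  [k+1]*[n+1]C[k+1]≡[n+1]*nCk zero    zero    = refl
  [k+1]*[n+1]C[k+1]≡[n+1]*nCk zero    (suc k) = ℕ.*-zeroʳ (suc (suc k))
  [k+1]*[n+1]C[k+1]≡[n+1]*nCk (suc n) zero    =
    trans (ℕ.*-identityˡ _) (trans (nC1≡n (suc (suc n))) (sym (ℕ.*-identityʳ _)))
  [k+1]*[n+1]C[k+1]≡[n+1]*nCk (suc n) (suc k) = begin
    suc (suc k) ℕ.* (suc (suc n) C suc (suc k))
      ≡⟨ cong (suc (suc k) ℕ.*_) (nCk+nC[k+1]≡[n+1]C[k+1] (suc n) (suc k)) ⟨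
    suc (suc k) ℕ.* (suc n C suc k ℕ.+ suc n C suc (suc k))
      ≡⟨ expand (suc k) (suc n C suc k) (suc n C suc (suc k)) ⟩
    suc k ℕ.* (suc n C suc k) ℕ.+ suc n C suc k ℕ.+ suc (suc k) ℕ.* (suc n C suc (suc k))
      ≡⟨ cong₂ (λ x y → x ℕ.+ suc n C suc k ℕ.+ y)
               ([k+1]*[n+1]C[k+1]≡[n+1]*nCk n k) ([k+1]*[n+1]C[k+1]≡[n+1]*nCk n (suc k)) ⟩
    suc n ℕ.* (n C k) ℕ.+ suc n C suc k ℕ.+ suc n ℕ.* (n C suc k)
      ≡⟨ collect (suc n) (n C k) (n C suc k) (suc n C suc k) ⟩
    suc n ℕ.* (n C k ℕ.+ n C suc k) ℕ.+ suc n C suc k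
      ≡⟨ cong (λ x → suc n ℕ.* x ℕ.+ suc n C suc k) (nCk+nC[k+1]≡[n+1]C[k+1] n k) ⟩
    suc n ℕ.* (suc n C suc k) ℕ.+ suc n C suc k
      ≡⟨ ℕ.+-comm (suc n ℕ.* (suc n C suc k)) (suc n C suc k) ⟩
    suc (suc n) ℕ.* (suc n C suc k) ∎
    where
    open ≡-Reasoning
    expand : ∀ k a b → suc k ℕ.* (a ℕ.+ b) ≡ k ℕ.* a ℕ.+ a ℕ.+ suc k ℕ.* b
    expand = ℕ-Solver.solve-∀
    collect : ∀ n a b c → n ℕ.* a ℕ.+ c ℕ.+ n ℕ.* b ≡ n ℕ.* (a ℕ.+ b) ℕ.+ c
    collect = ℕ-Solver.solve-∀

  alternatingSum : ℕ → (ℕ → ℤ) → ℤ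
  alternatingSum k g = ∑[ j < suc k ] (-1ℤ ^ j * + (k C j) * g j)

  alternatingSum-pascal : ∀ k g → alternatingSum (suc k) g ≡ alternatingSum k g - alternatingSum k (g ∘ suc)
  alternatingSum-pascal k g = begin
    alternatingSum (suc k) g
      ≡⟨ ∑-suc (suc k) _ ⟩
    a 0 + ∑[ i < suc k ] (-1ℤ ^ suc i * + (suc k C suc i) * g (suc i))
      ≡⟨ cong (_+_ (a 0)) (∑-cong (suc k) pascal) ⟩
    a 0 + ∑[ i < suc k ] (a (suc i) - b i)
      ≡⟨ cong (_+_ (a 0)) (∑-distrib-- (suc k) (a ∘ suc) b) ⟩
    a 0 + (∑[ i < suc k ] a (suc i) - alternatingSum k (g ∘ suc))
      ≡⟨ +-−-assoc (a 0) _ _ ⟩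
    a 0 + ∑[ i < suc k ] a (suc i) - alternatingSum k (g ∘ suc)
      ≡⟨ cong (_- alternatingSum k (g ∘ suc)) (∑-suc (suc k) a) ⟨
    ∑ (suc (suc k)) a - alternatingSum k (g ∘ suc)
      ≡⟨ cong (_- alternatingSum k (g ∘ suc)) (∑-pad a (ℕ.n≤1+n (suc k)) vanish) ⟩
    alternatingSum k g - alternatingSum k (g ∘ suc) ∎
    where
    open ≡-Reasoning
    a b : ℕ → ℤ
    a j = -1ℤ ^ j * + (k C j) * g j
    b i = -1ℤ ^ i * + (k C i) * g (suc i)
    +-−-assoc : ∀ x y z → x + (y - z) ≡ x + y - z
    +-−-assoc = solve-∀
    pascal : ∀ i → -1ℤ ^ suc i * + (suc k C suc i) * g (suc i) ≡ a (suc i) - b i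
    pascal i = trans
      (cong (λ c → -1ℤ ^ suc i * c * g (suc i))
        (trans (cong +_ (sym (nCk+nC[k+1]≡[n+1]C[k+1] k i))) (pos-+ (k C i) (k C suc i))))
      (distrib (-1ℤ ^ i) (+ (k C i)) (+ (k C suc i)) (g (suc i)))
      where
      distrib : ∀ s x y z → -1ℤ * s * (x + y) * z ≡ -1ℤ * s * y * z - s * x * z
      distrib = solve-∀
    vanish : ∀ j → suc k ℕ.≤ j → a j ≡ 0ℤ
    vanish j k<j = trans (cong (λ c → -1ℤ ^ j * + c * g j) (k>n⇒nCk≡0 k<j)) (zero-middle (-1ℤ ^ j) (g j))
      where
      zero-middle : ∀ x y → x * 0ℤ * y ≡ 0ℤ
      zero-middle = solve-∀

  alternatingSum-absorb : ∀ k g → alternatingSum (suc k) (λ j → + j * g j) ≡ - (+ suc k * alternatingSum k (g ∘ suc))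
  alternatingSum-absorb k g = begin
    alternatingSum (suc k) (λ j → + j * g j)
      ≡⟨ ∑-suc (suc k) _ ⟩
    0ℤ + ∑[ i < suc k ] (-1ℤ ^ suc i * + (suc k C suc i) * (+ suc i * g (suc i)))
      ≡⟨ +-identityˡ _ ⟩
    ∑[ i < suc k ] (-1ℤ ^ suc i * + (suc k C suc i) * (+ suc i * g (suc i)))
      ≡⟨ ∑-cong (suc k) absorb ⟩
    ∑[ i < suc k ] (- (+ suc k * (-1ℤ ^ i * + (k C i) * g (suc i))))
      ≡⟨ ∑-distrib-neg (suc k) _ ⟩
    - ∑[ i < suc k ] (+ suc k * (-1ℤ ^ i * + (k C i) * g (suc i)))
      ≡⟨ cong -_ (∑-distribˡ-* (suc k) (+ suc k) _) ⟩
    - (+ suc k * alternatingSum k (g ∘ suc)) ∎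
    where
    open ≡-Reasoning
    absorb : ∀ i → -1ℤ ^ suc i * + (suc k C suc i) * (+ suc i * g (suc i))
                 ≡ - (+ suc k * (-1ℤ ^ i * + (k C i) * g (suc i)))
    absorb i = begin
      -1ℤ ^ suc i * + (suc k C suc i) * (+ suc i * g (suc i))
        ≡⟨ regroup (-1ℤ ^ i) (+ (suc k C suc i)) (+ suc i) (g (suc i)) ⟩
      - (-1ℤ ^ i * (+ suc i * + (suc k C suc i)) * g (suc i))
        ≡⟨ cong (λ c → - (-1ℤ ^ i * c * g (suc i)))
                (pos-*-pos (suc i) (suc k C suc i) (suc k) (k C i) ([k+1]*[n+1]C[k+1]≡[n+1]*nCk k i)) ⟩
      - (-1ℤ ^ i * (+ suc k * + (k C i)) * g (suc i))
        ≡⟨ cong -_ (regroup′ (-1ℤ ^ i) (+ suc k) (+ (k C i)) (g (suc i))) ⟩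
      - (+ suc k * (-1ℤ ^ i * + (k C i) * g (suc i))) ∎
      where
      regroup : ∀ s c x y → -1ℤ * s * c * (x * y) ≡ - (s * (x * c) * y)
      regroup = solve-∀
      regroup′ : ∀ s x c y → s * (x * c) * y ≡ x * (s * c * y)
      regroup′ = solve-∀
      pos-*-pos : ∀ a b c d → a ℕ.* b ≡ c ℕ.* d → + a * + b ≡ + c * + d
      pos-*-pos a b c d eq = trans (sym (pos-* a b)) (trans (cong +_ eq) (pos-* c d))

  stirling-alternatingSum : ∀ n k → -1ℤ ^ k * + (k ! ℕ.* S n k) ≡ alternatingSum k (λ j → + (j ℕ.^ n))
  stirling-alternatingSum zero    zero    = refl
  stirling-alternatingSum zero    (suc k) = begin
    -1ℤ ^ suc k * + ((suc k) ! ℕ.* 0) ≡⟨ cong (λ x → -1ℤ ^ suc k * + x) (ℕ.*-zeroʳ ((suc k) !)) ⟩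
    -1ℤ ^ suc k * 0ℤ                  ≡⟨ times-zero (-1ℤ ^ suc k) (alternatingSum k (λ _ → 1ℤ)) ⟩
    alternatingSum k (λ _ → 1ℤ) - alternatingSum k (λ _ → 1ℤ)
                                       ≡⟨ alternatingSum-pascal k (λ _ → 1ℤ) ⟨
    alternatingSum (suc k) (λ _ → 1ℤ) ∎
    where
    open ≡-Reasoning
    times-zero : ∀ s x → s * 0ℤ ≡ x - x
    times-zero = solve-∀
  stirling-alternatingSum (suc n) zero    = refl
  stirling-alternatingSum (suc n) (suc k) = begin
    -1ℤ ^ suc k * + ((suc k) ! ℕ.* S (suc n) (suc k))
      ≡⟨ cong (-1ℤ ^ suc k *_) cast ⟩
    -1ℤ ^ suc k * (K * F * (K * a + c))
      ≡⟨ regroup (-1ℤ ^ k) K F a c ⟩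
    K * (-1ℤ ^ suc k * (K * F * a) - -1ℤ ^ k * (F * c))
      ≡⟨ cong₂ (λ x y → K * (x - y))
               (IH (suc k) (trans (pos-* ((suc k) !) _) (cong (_* a) (pos-* (suc k) (k !)))))
               (IH k (pos-* (k !) _)) ⟩
    K * (A (suc k) - A k)
      ≡⟨ cong (λ x → K * (x - A k)) (alternatingSum-pascal k (λ j → + (j ℕ.^ n))) ⟩
    K * (A k - B - A k)
      ≡⟨ cancel K (A k) B ⟩
    - (K * B)
      ≡⟨ alternatingSum-absorb k (λ j → + (j ℕ.^ n)) ⟨
    alternatingSum (suc k) (λ j → + j * + (j ℕ.^ n))
      ≡⟨ ∑-cong (suc (suc k)) (λ j → cong (-1ℤ ^ j * + (suc k C j) *_) (pos-* j (j ℕ.^ n))) ⟨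
    alternatingSum (suc k) (λ j → + (j ℕ.^ suc n)) ∎
    where
    open ≡-Reasoning
    K F a c B : ℤ
    K = + suc k
    F = + (k !)
    a = + S n (suc k)
    c = + S n k
    A : ℕ → ℤ
    A k = alternatingSum k (λ j → + (j ℕ.^ n))
    B = alternatingSum k (λ j → + (suc j ℕ.^ n))
    cast : + ((suc k) ! ℕ.* S (suc n) (suc k)) ≡ K * F * (K * a + c)
    cast = trans (pos-* ((suc k) !) _) (cong₂ _*_ (pos-* (suc k) (k !))
             (trans (pos-+ (suc k ℕ.* S n (suc k)) (S n k)) (cong (_+ c) (pos-* (suc k) (S n (suc k))))))
    IH : ∀ k {x} → + (k ! ℕ.* S n k) ≡ x → -1ℤ ^ k * x ≡ A k
    IH k eq = trans (cong (-1ℤ ^ k *_) (sym eq)) (stirling-alternatingSum n k)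
    regroup : ∀ s K F a c → -1ℤ * s * (K * F * (K * a + c)) ≡ K * (-1ℤ * s * (K * F * a) - s * (F * c))
    regroup = solve-∀
    cancel : ∀ K x y → K * (x - y - x) ≡ - (K * y)
    cancel = solve-∀

module PowersOfOddNumbers where

  open import Data.Nat as ℕ using (ℕ; zero; suc)
  import Data.Nat.Properties as ℕ
  import Data.Nat.Tactic.RingSolver as ℕ-Solver
  open import Data.Integer using (ℤ; +_; 0ℤ; 1ℤ; _+_; _*_; _-_)
  open import Data.Integer.Properties using (pos-*; *-comm)
  open import Data.Integer.Divisibility.Signed using (_∣_; divides; ∣-refl; ∣m∣n⇒∣m+n)
  open import Data.Integer.Tactic.RingSolver using (solve-∀)
  open import Data.Product using (∃-syntax; _,_)
  open import Relation.Binary.PropositionalEquality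
  open IntegerDivisibility

  _^2^_−1 : ℕ → ℕ → ℤ
  t ^2^ u −1 = + (t ℕ.^ (2 ℕ.^ u)) - 1ℤ

  ^2^suc−1 : ∀ t u → t ^2^ suc u −1 ≡ t ^2^ u −1 * (t ^2^ u −1 + + 2)
  ^2^suc−1 t u = begin
    + (t ℕ.^ (2 ℕ.^ u ℕ.+ (2 ℕ.^ u ℕ.+ 0))) - 1ℤ
      ≡⟨ cong (λ e → + (t ℕ.^ (2 ℕ.^ u ℕ.+ e)) - 1ℤ) (ℕ.+-identityʳ (2 ℕ.^ u)) ⟩
    + (t ℕ.^ (2 ℕ.^ u ℕ.+ 2 ℕ.^ u)) - 1ℤ
      ≡⟨ cong (λ x → + x - 1ℤ) (ℕ.^-distribˡ-+-* t (2 ℕ.^ u) (2 ℕ.^ u)) ⟩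
    + (X ℕ.* X) - 1ℤ
      ≡⟨ cong (_- 1ℤ) (pos-* X X) ⟩
    + X * + X - 1ℤ
      ≡⟨ factor (+ X) ⟩
    (+ X - 1ℤ) * (+ X - 1ℤ + + 2) ∎
    where
    open ≡-Reasoning
    X = t ℕ.^ (2 ℕ.^ u)
    factor : ∀ x → x * x - 1ℤ ≡ (x - 1ℤ) * (x - 1ℤ + + 2)
    factor = solve-∀

  ^2^−1-∣ : ∀ {a} t u r → 2^ suc a ∣ t ^2^ u −1 → 2^ (r ℕ.+ suc a) ∣ t ^2^ (r ℕ.+ u) −1
  ^2^−1-∣         t u zero    2^a+1∣ = 2^a+1∣
  ^2^−1-∣ {a} t u (suc r) 2^a+1∣ =
    subst₂ (λ e y → 2^ e ∣ y) (ℕ.+-comm (r ℕ.+ suc a) 1) (sym (^2^suc−1 t (r ℕ.+ u)))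
      (2^-∣-* {r ℕ.+ suc a} {1} 2^e∣Y (∣m∣n⇒∣m+n 2∣Y ∣-refl))
    where
    2^e∣Y : 2^ (r ℕ.+ suc a) ∣ t ^2^ (r ℕ.+ u) −1
    2^e∣Y = ^2^−1-∣ t u r 2^a+1∣
    2∣Y : 2^ 1 ∣ t ^2^ (r ℕ.+ u) −1
    2∣Y = 2^-∣-weaken (ℕ.≤-trans (ℕ.s≤s ℕ.z≤n) (ℕ.m≤n+m (suc a) r)) 2^e∣Y

  ^2^−1-lift : ∀ {a} t u r → 2^ suc a ∣ t ^2^ u −1 →
               2^ (r ℕ.+ (suc a ℕ.+ a)) ∣ t ^2^ (r ℕ.+ u) −1 - 2^ r * t ^2^ u −1
  ^2^−1-lift t u zero 2^a+1∣ = divides 0ℤ (x-1*x (t ^2^ u −1))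
    where
    x-1*x : ∀ x → x - + 1 * x ≡ 0ℤ
    x-1*x = solve-∀
  ^2^−1-lift {a} t u (suc r) 2^a+1∣ =
    subst (2^ (suc r ℕ.+ (suc a ℕ.+ a)) ∣_) (sym expand)
      (∣m∣n⇒∣m+n (2^-∣-* {1} {r ℕ.+ (suc a ℕ.+ a)} ∣-refl (^2^−1-lift {a} t u r 2^a+1∣))
                 (2^-∣-weaken {suc r ℕ.+ (suc a ℕ.+ a)} e≤e+e (2^-∣-* {r ℕ.+ suc a} {r ℕ.+ suc a} 2^e∣Z 2^e∣Z)))
    where
    Z Y : ℤ
    Z = t ^2^ (r ℕ.+ u) −1
    Y = t ^2^ u −1
    2^e∣Z : 2^ (r ℕ.+ suc a) ∣ Z
    2^e∣Z = ^2^−1-∣ {a} t u r 2^a+1∣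
    e≤e+e : suc r ℕ.+ (suc a ℕ.+ a) ℕ.≤ r ℕ.+ suc a ℕ.+ (r ℕ.+ suc a)
    e≤e+e = ℕ.≤-trans (ℕ.m≤m+n _ r) (ℕ.≤-reflexive (regroup r a))
      where
      regroup : ∀ r a → suc r ℕ.+ (suc a ℕ.+ a) ℕ.+ r ≡ r ℕ.+ suc a ℕ.+ (r ℕ.+ suc a)
      regroup = ℕ-Solver.solve-∀
    expand : t ^2^ suc (r ℕ.+ u) −1 - 2^ suc r * Y ≡ + 2 * (Z - 2^ r * Y) + Z * Z
    expand = begin
      t ^2^ suc (r ℕ.+ u) −1 - 2^ suc r * Y ≡⟨ cong₂ (λ x p → x - p * Y) (^2^suc−1 t (r ℕ.+ u)) (2^-suc r) ⟩
      Z * (Z + + 2) - + 2 * 2^ r * Y        ≡⟨ rearrange Z (2^ r) Y ⟩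
      + 2 * (Z - 2^ r * Y) + Z * Z          ∎
      where
      open ≡-Reasoning
      rearrange : ∀ z p y → z * (z + + 2) - + 2 * p * y ≡ + 2 * (z - p * y) + z * z
      rearrange = solve-∀

  odd-square : ∀ i → ∃[ h ] suc (2 ℕ.* i) ℕ.^ 2 ≡ suc (8 ℕ.* h)
  odd-square zero    = 0 , refl
  odd-square (suc i) with h , t²≡1+8h ← odd-square i = h ℕ.+ suc i , (begin
    suc (2 ℕ.* suc i) ℕ.^ 2           ≡⟨ step i ⟩
    suc (2 ℕ.* i) ℕ.^ 2 ℕ.+ 8 ℕ.* suc i ≡⟨ cong (ℕ._+ 8 ℕ.* suc i) t²≡1+8h ⟩
    suc (8 ℕ.* h) ℕ.+ 8 ℕ.* suc i     ≡⟨ collect h i ⟩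
    suc (8 ℕ.* (h ℕ.+ suc i))         ∎)
    where
    open ≡-Reasoning
    step : ∀ i → suc (2 ℕ.* suc i) ℕ.* (suc (2 ℕ.* suc i) ℕ.* 1)
               ≡ suc (2 ℕ.* i) ℕ.* (suc (2 ℕ.* i) ℕ.* 1) ℕ.+ 8 ℕ.* suc i
    step = ℕ-Solver.solve-∀
    collect : ∀ h i → suc (8 ℕ.* h) ℕ.+ 8 ℕ.* suc i ≡ suc (8 ℕ.* (h ℕ.+ suc i))
    collect = ℕ-Solver.solve-∀

  odd^2^−1-∣ : ∀ i u → 2^ (3 ℕ.+ u) ∣ suc (2 ℕ.* i) ^2^ suc u −1
  odd^2^−1-∣ i u = subst₂ (λ e x → 2^ e ∣ suc (2 ℕ.* i) ^2^ x −1) (ℕ.+-comm u 3) (ℕ.+-comm u 1)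
    (^2^−1-∣ {2} (suc (2 ℕ.* i)) 1 u 8∣t²-1)
    where
    8∣t²-1 : 2^ 3 ∣ suc (2 ℕ.* i) ^2^ 1 −1
    8∣t²-1 with h , t²≡1+8h ← odd-square i =
      divides (+ h) (trans (cong (λ x → + x - 1ℤ) t²≡1+8h) (trans (pos-* 8 h) (*-comm (+ 8) (+ h))))

module TwoAdicValuationOfFactorial where

  open import Data.Nat
  open import Data.Nat.Properties
  open import Data.Nat.Divisibility
  open import Data.Nat.DivMod using (_%_; _/_; m≡m%n+[m/n]*n; m%n<n; m/n<m; m/n*n≤m)
  open import Data.Nat.Tactic.RingSolver using (solve-∀)
  open import Data.Product using (∃-syntax; _,_)
  open import Relation.Binary.PropositionalEquality
  open import Relation.Nullary using (¬_)
  open import Defs using (ν₂-fuel; ν₂)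
  open IntegerDivisibility using (^-monoʳ-∣)

  1+x≡q*2⇒0<q : ∀ {x q} → suc x ≡ q * 2 → 0 < q
  1+x≡q*2⇒0<q {q = suc q} _ = s≤s z≤n

  ν₂-fuel-odd-part : ∀ f x → 0 < x → x ≤ f → ∃[ c ] x ≡ 2 ^ ν₂-fuel f x * suc (2 * c)
  ν₂-fuel-odd-part (suc f) (suc z) _ 1+z≤1+f
    with suc z % 2 | m≡m%n+[m/n]*n (suc z) 2 | m%n<n (suc z) 2
  ... | zero | 1+z≡q*2 | _
    with c , q≡2^v*odd ← ν₂-fuel-odd-part f (suc z / 2) (1+x≡q*2⇒0<q 1+z≡q*2)
                           (≤-pred (≤-trans (m/n<m (suc z) 2 (s≤s (s≤s z≤n))) 1+z≤1+f)) =
    c , (begin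
      suc z                                      ≡⟨ 1+z≡q*2 ⟩
      suc z / 2 * 2                              ≡⟨ cong (_* 2) q≡2^v*odd ⟩
      2 ^ ν₂-fuel f (suc z / 2) * suc (2 * c) * 2 ≡⟨ shift (2 ^ ν₂-fuel f (suc z / 2)) (suc (2 * c)) ⟩
      2 * 2 ^ ν₂-fuel f (suc z / 2) * suc (2 * c) ∎)
    where
    open ≡-Reasoning
    shift : ∀ p u → p * u * 2 ≡ 2 * p * u
    shift = solve-∀
  ... | suc zero | 1+z≡1+q*2 | _ = suc z / 2 , trans 1+z≡1+q*2 (odd (suc z / 2))
    where
    odd : ∀ q → suc (q * 2) ≡ 1 * suc (2 * q)
    odd = solve-∀
  ... | suc (suc _) | _ | s≤s (s≤s ())

  ν₂-odd-part : ∀ x .{{_ : NonZero x}} → ∃[ c ] x ≡ 2 ^ ν₂ x * suc (2 * c)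
  ν₂-odd-part (suc z) = ν₂-fuel-odd-part (suc z) (suc z) (s≤s z≤n) ≤-refl

  2∤odd : ∀ c → ¬ (2 ∣ suc (2 * c))
  2∤odd c 2∣odd with () ← ∣1⇒≡1 (∣m+n∣m⇒∣n (subst (2 ∣_) (+-comm 1 (2 * c)) 2∣odd) (m∣m*n c))

  2^-∣-2^-*-odd⇒≤ : ∀ {a v} c → 2 ^ a ∣ 2 ^ v * suc (2 * c) → a ≤ v
  2^-∣-2^-*-odd⇒≤ {a} {v} c 2^a∣ = ≮⇒≥ λ v<a →
    2∤odd c (*-cancelˡ-∣ (2 ^ v) {{m^n≢0 2 v}}
      (subst (_∣ 2 ^ v * suc (2 * c)) (*-comm 2 (2 ^ v))
        (∣-trans (^-monoʳ-∣ 2 v<a) 2^a∣)))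

  2^[3q]∣[4q]! : ∀ q → 2 ^ (3 * q) ∣ (4 * q) !
  2^[3q]∣[4q]! zero    = ∣-refl
  2^[3q]∣[4q]! (suc q) = subst₂ (λ e n → 2 ^ e ∣ n !) (sym (*-suc 3 q)) (sym (*-suc 4 q))
    (subst₂ _∣_ (sym (^-distribˡ-+-* 2 3 (3 * q))) (sym (four-factors q ((4 * q) !)))
      (*-monoʳ-∣ 8 (∣n⇒∣m*n ((1 + q) * (1 + 2 * q) * (3 + 4 * q) * (1 + 4 * q)) (2^[3q]∣[4q]! q))))
    where
    four-factors : ∀ q x → (4 + 4 * q) * ((3 + 4 * q) * ((2 + 4 * q) * ((1 + 4 * q) * x)))
                         ≡ 8 * ((1 + q) * (1 + 2 * q) * (3 + 4 * q) * (1 + 4 * q) * x)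
    four-factors = solve-∀

  3⌊k/4⌋≤ν₂[k!] : ∀ k → 3 * (k / 4) ≤ ν₂ (k !)
  3⌊k/4⌋≤ν₂[k!] k with c , k!≡2^v*odd ← ν₂-odd-part (k !) {{k !≢0}} =
    2^-∣-2^-*-odd⇒≤ c (subst (2 ^ (3 * (k / 4)) ∣_) k!≡2^v*odd
      (∣-trans (2^[3q]∣[4q]! (k / 4)) (m≤n⇒m!∣n! (subst (_≤ k) (*-comm (k / 4) 4) (m/n*n≤m k 4)))))

module DifferenceOfStirlingNumbers where

  open import Data.Nat as ℕ using (ℕ; zero; suc; _!)
  import Data.Nat.Properties as ℕ
  import Data.Nat.Divisibility as ℕ
  open import Data.Nat.Combinatorics using (_C_; k>n⇒nCk≡0)
  import Data.Nat.Tactic.RingSolver as ℕ-Solver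
  open import Data.Integer using (ℤ; +_; 0ℤ; 1ℤ; -1ℤ; _+_; _*_; -_; _-_; _^_)
  open import Data.Integer.Properties using (pos-*; m-n≡m⊖n; ⊖-≥; +-identityʳ; *-identityˡ; *-zeroʳ; ^-*-assoc; ^-zeroˡ)
  open import Data.Integer.Divisibility.Signed using (_∣_; ∣ᵤ⇒∣; ∣m⇒∣m*n; ∣n⇒∣m*n)
  open import Data.Integer.Tactic.RingSolver using (solve-∀)
  open import Data.Product using (∃-syntax; _,_)
  open import Function.Bundles using (_⇔_)
  open import Function.Properties.Equivalence using (⇔-setoid)
  open import Level using (0ℓ)
  import Relation.Binary.Reasoning.Setoid as SetoidReasoning
  open import Relation.Binary.PropositionalEquality
  open import Defs using (S; _≡_[mod2^_]; f; sₖ)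
  open FiniteSum
  open IntegerDivisibility
  open ExplicitStirling
  open PowersOfOddNumbers

  module ⇔-Reasoning = SetoidReasoning (⇔-setoid 0ℓ)

  evenSum oddSum : ℕ → ℕ → ℕ → ℤ
  evenSum k n u = ∑[ i < suc k ] (+ (k C (2 ℕ.* i)) * + ((2 ℕ.* i) ℕ.^ n) * (2 ℕ.* i) ^2^ u −1)
  oddSum  k n u = ∑[ i < suc k ] (+ (k C suc (2 ℕ.* i)) * + (suc (2 ℕ.* i) ℕ.^ n) * suc (2 ℕ.* i) ^2^ u −1)

  -1^[2i]≡1 : ∀ i → -1ℤ ^ (2 ℕ.* i) ≡ 1ℤ
  -1^[2i]≡1 i = trans (sym (^-*-assoc -1ℤ 2 i)) (^-zeroˡ i)

  stirling-difference : ∀ k n m →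
    -1ℤ ^ k * (+ (k !) * (+ S (n ℕ.+ 2 ℕ.^ m) k - + S n k)) ≡ evenSum k n m - oddSum k n m
  stirling-difference k n m = begin
    -1ℤ ^ k * (+ (k !) * (+ S (n ℕ.+ 2 ℕ.^ m) k - + S n k))
      ≡⟨ distrib (-1ℤ ^ k) (+ (k !)) (+ S (n ℕ.+ 2 ℕ.^ m) k) (+ S n k) ⟩
    -1ℤ ^ k * (+ (k !) * + S (n ℕ.+ 2 ℕ.^ m) k) - -1ℤ ^ k * (+ (k !) * + S n k)
      ≡⟨ cong₂ (λ x y → -1ℤ ^ k * x - -1ℤ ^ k * y) (pos-* (k !) _) (pos-* (k !) _) ⟨
    -1ℤ ^ k * + (k ! ℕ.* S (n ℕ.+ 2 ℕ.^ m) k) - -1ℤ ^ k * + (k ! ℕ.* S n k)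
      ≡⟨ cong₂ _-_ (stirling-alternatingSum (n ℕ.+ 2 ℕ.^ m) k) (stirling-alternatingSum n k) ⟩
    alternatingSum k (λ j → + (j ℕ.^ (n ℕ.+ 2 ℕ.^ m))) - alternatingSum k (λ j → + (j ℕ.^ n))
      ≡⟨ ∑-distrib-- (suc k) _ _ ⟨
    ∑[ j < suc k ] (-1ℤ ^ j * + (k C j) * + (j ℕ.^ (n ℕ.+ 2 ℕ.^ m)) - -1ℤ ^ j * + (k C j) * + (j ℕ.^ n))
      ≡⟨ ∑-cong (suc k) factor ⟩
    ∑ (suc k) term
      ≡⟨ ∑-pad term (ℕ.m≤m+n (suc k) (suc k)) vanish ⟨
    ∑ (suc k ℕ.+ suc k) term
      ≡⟨ ∑-even-odd (suc k) term ⟩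
    ∑[ i < suc k ] term (2 ℕ.* i) + ∑[ i < suc k ] term (suc (2 ℕ.* i))
      ≡⟨ cong₂ _+_ (∑-cong (suc k) even) (trans (∑-cong (suc k) odd) (∑-distrib-neg (suc k) _)) ⟩
    evenSum k n m - oddSum k n m ∎
    where
    open ≡-Reasoning
    term : ℕ → ℤ
    term j = -1ℤ ^ j * (+ (k C j) * + (j ℕ.^ n) * j ^2^ m −1)
    distrib : ∀ s f a b → s * (f * (a - b)) ≡ s * (f * a) - s * (f * b)
    distrib = solve-∀
    factor : ∀ j → -1ℤ ^ j * + (k C j) * + (j ℕ.^ (n ℕ.+ 2 ℕ.^ m)) - -1ℤ ^ j * + (k C j) * + (j ℕ.^ n) ≡ term j
    factor j = trans (cong (λ x → -1ℤ ^ j * + (k C j) * x - -1ℤ ^ j * + (k C j) * + (j ℕ.^ n))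
                         (trans (cong +_ (ℕ.^-distribˡ-+-* j n (2 ℕ.^ m))) (pos-* (j ℕ.^ n) _)))
                 (regroup (-1ℤ ^ j) (+ (k C j)) (+ (j ℕ.^ n)) (+ (j ℕ.^ (2 ℕ.^ m))))
      where
      regroup : ∀ s c a b → s * c * (a * b) - s * c * a ≡ s * (c * a * (b - 1ℤ))
      regroup = solve-∀
    vanish : ∀ j → suc k ℕ.≤ j → term j ≡ 0ℤ
    vanish j k<j = trans (cong (λ c → -1ℤ ^ j * (+ c * + (j ℕ.^ n) * j ^2^ m −1)) (k>n⇒nCk≡0 k<j))
                         (*-zeroʳ (-1ℤ ^ j))
    evenTerm oddTerm : ℕ → ℤ
    evenTerm i = + (k C (2 ℕ.* i)) * + ((2 ℕ.* i) ℕ.^ n) * (2 ℕ.* i) ^2^ m −1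
    oddTerm  i = + (k C suc (2 ℕ.* i)) * + (suc (2 ℕ.* i) ℕ.^ n) * suc (2 ℕ.* i) ^2^ m −1
    even : ∀ i → term (2 ℕ.* i) ≡ evenTerm i
    even i = trans (cong (_* evenTerm i) (-1^[2i]≡1 i)) (*-identityˡ (evenTerm i))
    odd : ∀ i → term (suc (2 ℕ.* i)) ≡ - oddTerm i
    odd i = trans (cong (λ s → -1ℤ * s * oddTerm i) (-1^[2i]≡1 i)) (-1*1*x≡-x (oddTerm i))
      where
      -1*1*x≡-x : ∀ x → -1ℤ * 1ℤ * x ≡ - x
      -1*1*x≡-x = solve-∀

  2^n∣[2i]^n : ∀ i n → 2 ℕ.^ n ℕ.∣ (2 ℕ.* i) ℕ.^ n
  2^n∣[2i]^n i zero    = ℕ.∣-refl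
  2^n∣[2i]^n i (suc n) = ℕ.*-pres-∣ (ℕ.m∣m*n {2} i) (2^n∣[2i]^n i n)

  2^n∣evenSum : ∀ k n u → 2^ n ∣ evenSum k n u
  2^n∣evenSum k n u = ∑-∣ (suc k) _ λ i →
    ∣m⇒∣m*n ((2 ℕ.* i) ^2^ u −1) (∣n⇒∣m*n (+ (k C (2 ℕ.* i))) (∣ᵤ⇒∣ (2^n∣[2i]^n i n)))

  oddSum-lift : ∀ k n s r →
    2^ (r ℕ.+ (2 ℕ.* s ℕ.+ 4)) ∣ oddSum k n (r ℕ.+ suc s) - 2^ r * oddSum k n (suc s)
  oddSum-lift k n s r =
    subst (2^ (r ℕ.+ (2 ℕ.* s ℕ.+ 4)) ∣_)
      (trans (∑-distrib-- (suc k) _ _) (cong (_-_ (oddSum k n (r ℕ.+ suc s))) (∑-distribˡ-* (suc k) (2^ r) _)))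
      (∑-∣ (suc k) _ λ i → let t = suc (2 ℕ.* i) in
        subst (2^ (r ℕ.+ (2 ℕ.* s ℕ.+ 4)) ∣_)
          (sym (factor (+ (k C t)) (+ (t ℕ.^ n)) (t ^2^ (r ℕ.+ suc s) −1) (2^ r) (t ^2^ suc s −1)))
          (∣n⇒∣m*n (+ (k C t) * + (t ℕ.^ n))
            (2^-∣-weaken {r ℕ.+ (2 ℕ.* s ℕ.+ 4)} (ℕ.+-monoʳ-≤ r (2s+4≤[3+s]+[2+s] s))
              (^2^−1-lift {suc (suc s)} t (suc s) r (odd^2^−1-∣ i s)))))
    where
    2s+4≤[3+s]+[2+s] : ∀ s → 2 ℕ.* s ℕ.+ 4 ℕ.≤ 3 ℕ.+ s ℕ.+ (2 ℕ.+ s)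
    2s+4≤[3+s]+[2+s] s = ℕ.≤-trans (ℕ.n≤1+n _) (ℕ.≤-reflexive (exact s))
      where
      exact : ∀ s → suc (2 ℕ.* s ℕ.+ 4) ≡ 3 ℕ.+ s ℕ.+ (2 ℕ.+ s)
      exact = ℕ-Solver.solve-∀
    factor : ∀ c a y p z → c * a * y - p * (c * a * z) ≡ c * a * (y - p * z)
    factor = solve-∀

  stirling-difference-criterion : ∀ {k n m s r v E} →
    ∃[ c ] k ! ≡ 2 ℕ.^ v ℕ.* suc (2 ℕ.* c) → m ≡ r ℕ.+ suc s →
    v ℕ.+ E ≡ r ℕ.+ (2 ℕ.* s ℕ.+ 4) → r ℕ.+ (2 ℕ.* s ℕ.+ 4) ℕ.≤ n →
    (S (n ℕ.+ 2 ℕ.^ m) k ≡ S n k [mod2^ E ]) ⇔ 2^ (2 ℕ.* s ℕ.+ 4) ∣ oddSum k n (suc s)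
  stirling-difference-criterion {k} {n} {m} {s} {r} {v} {E} (c , k!≡2^v*odd) m≡r+s+1 v+E≡r+T r+T≤n = begin
    S (n ℕ.+ 2 ℕ.^ m) k ≡ S n k [mod2^ E ]       ≈⟨ %≡%⇔∣- _ _ (2 ℕ.^ E) {{ℕ.m^n≢0 2 E}} ⟩
    2^ E ∣ Δ                                      ≈⟨ 2^-*-∣⇔ v ⟩
    2^ (v ℕ.+ E) ∣ 2^ v * Δ                       ≈⟨ odd-*-∣⇔ {v ℕ.+ E} c ⟩
    2^ (v ℕ.+ E) ∣ + suc (2 ℕ.* c) * (2^ v * Δ)   ≈⟨ ∣-sign⇔ k ⟩
    2^ (v ℕ.+ E) ∣ -1ℤ ^ k * (+ suc (2 ℕ.* c) * (2^ v * Δ))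
      ≡⟨ cong₂ (λ e x → 2^ e ∣ -1ℤ ^ k * x) v+E≡r+T k!Δ ⟩
    2^ (r ℕ.+ T) ∣ -1ℤ ^ k * (+ (k !) * Δ)        ≡⟨ cong (2^ (r ℕ.+ T) ∣_) (stirling-difference k n m) ⟩
    2^ (r ℕ.+ T) ∣ evenSum k n m - oddSum k n m
      ≈⟨ ∣m⇒∣m-n⇔∣n (2^-∣-weaken {r ℕ.+ T} r+T≤n (2^n∣evenSum k n m)) ⟩
    2^ (r ℕ.+ T) ∣ oddSum k n m                   ≡⟨ cong (λ u → 2^ (r ℕ.+ T) ∣ oddSum k n u) m≡r+s+1 ⟩
    2^ (r ℕ.+ T) ∣ oddSum k n (r ℕ.+ suc s)       ≈⟨ ∣m-n⇒∣m⇔∣n (oddSum-lift k n s r) ⟩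
    2^ (r ℕ.+ T) ∣ 2^ r * oddSum k n (suc s)      ≈⟨ 2^-*-∣⇔ r ⟨
    2^ T ∣ oddSum k n (suc s)                     ∎
    where
    open ⇔-Reasoning
    T = 2 ℕ.* s ℕ.+ 4
    Δ = + S (n ℕ.+ 2 ℕ.^ m) k - + S n k
    k!Δ : + suc (2 ℕ.* c) * (2^ v * Δ) ≡ + (k !) * Δ
    k!Δ = trans (swap (+ suc (2 ℕ.* c)) (2^ v) Δ)
                (cong (_* Δ) (sym (trans (cong +_ k!≡2^v*odd) (pos-* (2 ℕ.^ v) (suc (2 ℕ.* c))))))
      where
      swap : ∀ u p x → u * (p * x) ≡ p * u * x
      swap = solve-∀

  f≡oddSum : ∀ k ℓ n → + f k ℓ n ≡ oddSum k n (suc (sₖ k ℓ))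
  f≡oddSum k ℓ n = begin
    + f k ℓ n                          ≡⟨ +-Σ₁ ℕ.⌈ k /2⌉ _ ⟩
    ∑[ i < ℕ.⌈ k /2⌉ ] (+ g (2 ℕ.* suc i ℕ.∸ 1)) ≡⟨ ∑-cong ℕ.⌈ k /2⌉ cast ⟩
    ∑ ℕ.⌈ k /2⌉ term                   ≡⟨ ∑-pad term ⌈k/2⌉≤1+k vanish ⟨
    oddSum k n (suc s)                 ∎
    where
    open ≡-Reasoning
    s = sₖ k ℓ
    g : ℕ → ℕ
    g t = (k C t) ℕ.* t ℕ.^ n ℕ.* (t ℕ.^ (2 ℕ.^ (s ℕ.+ 1)) ℕ.∸ 1)
    term : ℕ → ℤ
    term i = + (k C suc (2 ℕ.* i)) * + (suc (2 ℕ.* i) ℕ.^ n) * suc (2 ℕ.* i) ^2^ suc s −1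
    +[x∸1] : ∀ x → 0 ℕ.< x → + (x ℕ.∸ 1) ≡ + x - 1ℤ
    +[x∸1] x 0<x = trans (sym (⊖-≥ 0<x)) (sym (m-n≡m⊖n x 1))
    cast : ∀ i → + g (2 ℕ.* suc i ℕ.∸ 1) ≡ term i
    cast i = begin
      + g (2 ℕ.* suc i ℕ.∸ 1)   ≡⟨ cong (λ t → + g t) (ℕ.+-suc i (i ℕ.+ 0)) ⟩
      + g t                      ≡⟨ pos-* ((k C t) ℕ.* t ℕ.^ n) _ ⟩
      + ((k C t) ℕ.* t ℕ.^ n) * + (t ℕ.^ (2 ℕ.^ (s ℕ.+ 1)) ℕ.∸ 1)
        ≡⟨ cong₂ _*_ (pos-* (k C t) (t ℕ.^ n)) (+[x∸1] _ (ℕ.m^n>0 t (2 ℕ.^ (s ℕ.+ 1)))) ⟩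
      + (k C t) * + (t ℕ.^ n) * (+ (t ℕ.^ (2 ℕ.^ (s ℕ.+ 1))) - 1ℤ)
        ≡⟨ cong (λ e → + (k C t) * + (t ℕ.^ n) * t ^2^ e −1) (ℕ.+-comm s 1) ⟩
      term i                     ∎
      where t = suc (2 ℕ.* i)
    ⌈k/2⌉≤1+k : ℕ.⌈ k /2⌉ ℕ.≤ suc k
    ⌈k/2⌉≤1+k = ℕ.m≤n⇒m≤1+n (ℕ.⌈n/2⌉≤n k)
    vanish : ∀ i → ℕ.⌈ k /2⌉ ℕ.≤ i → term i ≡ 0ℤ
    vanish i ⌈k/2⌉≤i =
      cong (λ c → + c * + (suc (2 ℕ.* i) ℕ.^ n) * suc (2 ℕ.* i) ^2^ suc s −1) (k>n⇒nCk≡0 k<2i+1)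
      where
      k<2i+1 : k ℕ.< suc (2 ℕ.* i)
      k<2i+1 = ℕ.s≤s (ℕ.≤-trans (ℕ.≤-reflexive (sym (ℕ.⌊n/2⌋+⌈n/2⌉≡n k)))
                       (ℕ.≤-trans (ℕ.+-monoˡ-≤ ℕ.⌈ k /2⌉ (ℕ.⌊n/2⌋≤⌈n/2⌉ k))
                                  (ℕ.+-mono-≤ ⌈k/2⌉≤i (ℕ.≤-trans ⌈k/2⌉≤i (ℕ.m≤m+n i 0)))))

  f≡0[mod2^]⇔2^∣oddSum : ∀ k ℓ n e → (f k ℓ n ≡ 0 [mod2^ e ]) ⇔ 2^ e ∣ oddSum k n (suc (sₖ k ℓ))
  f≡0[mod2^]⇔2^∣oddSum k ℓ n e = begin
    f k ℓ n ≡ 0 [mod2^ e ]            ≈⟨ %≡%⇔∣- (f k ℓ n) 0 (2 ℕ.^ e) {{ℕ.m^n≢0 2 e}} ⟩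
    2^ e ∣ + f k ℓ n - + 0            ≡⟨ cong (2^ e ∣_) (trans (+-identityʳ (+ f k ℓ n)) (f≡oddSum k ℓ n)) ⟩
    2^ e ∣ oddSum k n (suc (sₖ k ℓ))  ∎
    where open ⇔-Reasoning

module ExponentArithmetic where

  open import Data.Nat
  open import Data.Nat.Properties
  open import Data.Nat.DivMod using (_%_; _/_; m≡m%n+[m/n]*n; m%n<n)
  open import Data.Nat.Logarithm using (⌈log₂_⌉; ⌈log₂⌉-mono-≤; ⌈log₂2^n⌉≡n)
  open import Data.Nat.Tactic.RingSolver using (solve-∀)
  open import Data.Product using (_×_; _,_)
  open import Relation.Binary.PropositionalEquality

  n<2^n : ∀ n → n < 2 ^ n
  n<2^n zero    = s≤s z≤n
  n<2^n (suc n) = +-mono-≤-< (m^n>0 2 n) (subst (n <_) (sym (+-identityʳ (2 ^ n))) (n<2^n n))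

  ⌈log₂k⌉≤⌊k/4⌋+2 : ∀ k → ⌈log₂ k ⌉ ≤ k / 4 + 2
  ⌈log₂k⌉≤⌊k/4⌋+2 k = begin
    ⌈log₂ k ⌉                 ≤⟨ ⌈log₂⌉-mono-≤ k≤2^[q+2] ⟩
    ⌈log₂ (2 ^ (k / 4 + 2)) ⌉ ≡⟨ ⌈log₂2^n⌉≡n (k / 4 + 2) ⟩
    k / 4 + 2                 ∎
    where
    open ≤-Reasoning
    k≤2^[q+2] : k ≤ 2 ^ (k / 4 + 2)
    k≤2^[q+2] = begin
      k                       ≡⟨ m≡m%n+[m/n]*n k 4 ⟩
      k % 4 + k / 4 * 4       ≤⟨ +-monoˡ-≤ (k / 4 * 4) (<⇒≤ (m%n<n k 4)) ⟩
      4 + k / 4 * 4           ≡⟨⟩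
      suc (k / 4) * 4         ≤⟨ *-monoˡ-≤ 4 (n<2^n (k / 4)) ⟩
      2 ^ (k / 4) * 4         ≡⟨ ^-distribˡ-+-* 2 (k / 4) 2 ⟨
      2 ^ (k / 4 + 2)         ∎

  ≤-witness : ∀ {x y} d → x + d ≡ y → x ≤ y
  ≤-witness {x} d x+d≡y = ≤-trans (m≤m+n x d) (≤-reflexive x+d≡y)

  b+3≤w∧2b+2≤w : ∀ {b q w} → b ≤ q → 1 ≤ q → 3 * q + 1 ≤ w → b + 3 ≤ w × b + b + 2 ≤ w
  b+3≤w∧2b+2≤w {b} {suc p} {w} b≤q (s≤s z≤n) 3q+1≤w =
    ≤-trans (+-monoˡ-≤ 3 b≤q) (≤-trans (≤-witness (p + p) (slack₁ p)) 3q+1≤w) ,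
    ≤-trans (+-monoˡ-≤ 2 (+-mono-≤ b≤q b≤q)) (≤-trans (≤-witness p (slack₂ p)) 3q+1≤w)
    where
    slack₁ : ∀ p → suc p + 3 + (p + p) ≡ 3 * suc p + 1
    slack₁ = solve-∀
    slack₂ : ∀ p → suc p + suc p + 2 + p ≡ 3 * suc p + 1
    slack₂ = solve-∀

  w∸b∸3+[b+3]≡w : ∀ {w b} → b + 3 ≤ w → w ∸ b ∸ 3 + (b + 3) ≡ w
  w∸b∸3+[b+3]≡w {w} {b} b+3≤w = trans (cong (_+ (b + 3)) (∸-+-assoc w b 3)) (m∸n+n≡m b+3≤w)

  b≤w∸b∸3+1 : ∀ {w b} → b + 3 ≤ w → b + b + 2 ≤ w → b ≤ w ∸ b ∸ 3 + 1
  b≤w∸b∸3+1 {w} {b} b+3≤w 2b+2≤w = +-cancelʳ-≤ (b + 2) b (w ∸ b ∸ 3 + 1) (begin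
    b + (b + 2)               ≡⟨ +-assoc b b 2 ⟨
    b + b + 2                 ≤⟨ 2b+2≤w ⟩
    w                         ≡⟨ w∸b∸3+[b+3]≡w b+3≤w ⟨
    w ∸ b ∸ 3 + (b + 3)       ≡⟨ shift (w ∸ b ∸ 3) b ⟩
    w ∸ b ∸ 3 + 1 + (b + 2)   ∎)
    where
    open ≤-Reasoning
    shift : ∀ s b → s + (b + 3) ≡ s + 1 + (b + 2)
    shift = solve-∀

  m∸[1+s]+[2s+4]≡m+s+3 : ∀ {m s} → suc s ≤ m → m ∸ suc s + (2 * s + 4) ≡ m + s + 3
  m∸[1+s]+[2s+4]≡m+s+3 {m} {s} 1+s≤m =
    trans (regroup (m ∸ suc s) s) (cong (λ x → x + s + 3) (m∸n+n≡m 1+s≤m))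
    where
    regroup : ∀ x s → x + (2 * s + 4) ≡ x + suc s + s + 3
    regroup = solve-∀

  v+[m∸b+ℓ]≡m+s+3 : ∀ {v ℓ b m} → b + 3 ≤ v + ℓ → b ≤ m → v + (m ∸ b + ℓ) ≡ m + (v + ℓ ∸ b ∸ 3) + 3
  v+[m∸b+ℓ]≡m+s+3 {v} {ℓ} {b} {m} b+3≤v+ℓ b≤m = begin
    v + (m ∸ b + ℓ)             ≡⟨ swap v (m ∸ b) ℓ ⟩
    m ∸ b + (v + ℓ)             ≡⟨ cong (m ∸ b +_) (w∸b∸3+[b+3]≡w b+3≤v+ℓ) ⟨
    m ∸ b + (s + (b + 3))       ≡⟨ regroup (m ∸ b) s b ⟩
    m ∸ b + b + s + 3           ≡⟨ cong (λ x → x + s + 3) (m∸n+n≡m b≤m) ⟩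
    m + s + 3                   ∎
    where
    open ≡-Reasoning
    s = v + ℓ ∸ b ∸ 3
    swap : ∀ v x ℓ → v + (x + ℓ) ≡ x + (v + ℓ)
    swap = solve-∀
    regroup : ∀ x s b → x + (s + (b + 3)) ≡ x + b + s + 3
    regroup = solve-∀

  m∸[1+s]+[2s+4]≤n : ∀ {m s n} → suc s ≤ m → s + 3 ≤ 2 ^ m ∸ m → 2 ^ m ≤ n → m ∸ suc s + (2 * s + 4) ≤ n
  m∸[1+s]+[2s+4]≤n {m} {s} {n} 1+s≤m s+3≤2^m∸m 2^m≤n = begin
    m ∸ suc s + (2 * s + 4) ≡⟨ m∸[1+s]+[2s+4]≡m+s+3 1+s≤m ⟩
    m + s + 3               ≡⟨ +-assoc m s 3 ⟩
    m + (s + 3)             ≤⟨ +-monoʳ-≤ m s+3≤2^m∸m ⟩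
    m + (2 ^ m ∸ m)         ≡⟨ m+[n∸m]≡n (<⇒≤ (n<2^n m)) ⟩
    2 ^ m                   ≤⟨ 2^m≤n ⟩
    n                       ∎
    where open ≤-Reasoning


open import Data.Nat
open import Data.Nat.Properties
open import Data.Nat.DivMod using (/-monoˡ-≤)
open import Data.Product using (_×_; _,_)
open import Function.Bundles using (_⇔_)
import Function.Properties.Equivalence as ⇔
open import Relation.Binary.PropositionalEquality
open import Defs
open TwoAdicValuationOfFactorial
open ExponentArithmetic
open DifferenceOfStirlingNumbers

-- These make the truncated subtractions in sₖ k ℓ and in m ∸ b k exact.
b+3≤ν₂[k!]+ℓ∧2b+2≤ν₂[k!]+ℓ : ∀ {k ℓ} → 5 ≤ k → 1 ≤ ℓ →
  b k + 3 ≤ ν₂ (k !) + ℓ × b k + b k + 2 ≤ ν₂ (k !) + ℓ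
b+3≤ν₂[k!]+ℓ∧2b+2≤ν₂[k!]+ℓ {k} 5≤k 1≤ℓ =
  b+3≤w∧2b+2≤w b≤⌊k/4⌋ 1≤⌊k/4⌋ (+-mono-≤ (3⌊k/4⌋≤ν₂[k!] k) 1≤ℓ)
  where
  b≤⌊k/4⌋ : b k ≤ k / 4
  b≤⌊k/4⌋ = subst (b k ≤_) (m+n∸n≡m (k / 4) 2) (∸-monoˡ-≤ 2 (⌈log₂k⌉≤⌊k/4⌋+2 k))
  1≤⌊k/4⌋ : 1 ≤ k / 4
  1≤⌊k/4⌋ = /-monoˡ-≤ 4 (≤-trans (n≤1+n 4) 5≤k)

lemma5p1 : (k ℓ n m : ℕ) → 5 ≤ k → 1 ≤ ℓ → 1 ≤ n →
    sₖ k ℓ + 1 ≤ m → sₖ k ℓ + 3 ≤ 2 ^ m ∸ m → 2 ^ m ≤ n →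
    (S (n + 2 ^ m) k ≡ S n k [mod2^ (m ∸ b k + ℓ) ]) ⇔ (f k ℓ n ≡ 0 [mod2^ (2 * sₖ k ℓ + 4) ])
-- The hypothesis 1 ≤ n is implied by 2 ^ m ≤ n.
lemma5p1 k ℓ n m 5≤k 1≤ℓ _ s+1≤m s+3≤2^m∸m 2^m≤n =
  ⇔.trans (stirling-difference-criterion {k} {n} {m} {s} {v = v} {E = m ∸ b k + ℓ}
             (ν₂-odd-part (k !) {{k !≢0}}) m≡r+[1+s] v+E≡r+T r+T≤n)
          (⇔.sym (f≡0[mod2^]⇔2^∣oddSum k ℓ n (2 * s + 4)))
  where
  s = sₖ k ℓ
  v = ν₂ (k !)
  1+s≤m : suc s ≤ m
  1+s≤m = subst (_≤ m) (+-comm s 1) s+1≤m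
  m≡r+[1+s] : m ≡ m ∸ suc s + suc s
  m≡r+[1+s] = sym (m∸n+n≡m 1+s≤m)
  v+E≡r+T : v + (m ∸ b k + ℓ) ≡ m ∸ suc s + (2 * s + 4)
  v+E≡r+T with b+3≤v+ℓ , 2b+2≤v+ℓ ← b+3≤ν₂[k!]+ℓ∧2b+2≤ν₂[k!]+ℓ {k} 5≤k 1≤ℓ =
    trans (v+[m∸b+ℓ]≡m+s+3 {v} {ℓ} b+3≤v+ℓ (≤-trans (b≤w∸b∸3+1 b+3≤v+ℓ 2b+2≤v+ℓ) s+1≤m))
          (sym (m∸[1+s]+[2s+4]≡m+s+3 1+s≤m))
  r+T≤n : m ∸ suc s + (2 * s + 4) ≤ n
  r+T≤n = m∸[1+s]+[2s+4]≤n 1+s≤m s+3≤2^m∸m 2^m≤n
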